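{- Let $L$ be an extension of $\mathsf{N4}^\bot$. Then the ideal $\Delta_L$ of the Lindenbaum twist-structure of $L$ is closed if and only if $\neg\neg(p\wedge\sim p)\leftrightarrow(p\wedge\sim p)\in L$.
   Context: Language $\mathcal{L}_\sim=\{\wedge,\vee,\to,\bot,\sim\}$, formulas over a countable set of variables; $\neg\varphi:=\varphi\to\bot$, $\varphi\leftrightarrow\psi:=(\varphi\to\psi)\wedge(\psi\to\varphi)$. A logic in $\mathcal{L}_\sim$ is a set of formulas closed under substitution and modus ponens. $\mathsf{N4}^\bot$ is the least logic containing the intuitionistic axioms ($p\to(q\to p)$; $(p\to(q\to r))\to((p\to q)\to(p\to r))$; $p\wedge q\to p$; $p\wedge q\to q$; $p\to(q\to p\wedge q)$; $p\to p\vee q$; $q\to p\vee q$; $(p\to r)\to((q\to r)\to(p\vee q\to r))$; $\bot\to p$) and $\sim(p\vee q)\leftrightarrow(\sim p\wedge\sim q)$, $\sim(p\wedge q)\leftrightarrow(\sim p\vee\sim q)$, $\sim(p\to q)\leftrightarrow(p\wedge\sim q)$, $\sim\sim p\leftrightarrow p$, $\sim\bot$; an extension of it is a logic containing it. For such $L$, $\varphi\equiv_L\psi$ iff $\varphi\leftrightarrow\psi\in L$; $\mathcal{T}(L)$ is the Heyting algebra of classes $[\varphi]_L$ with $[\varphi]\vee[\psi]=[\varphi\vee\psi]$, $[\varphi]\wedge[\psi]=[\varphi\wedge\psi]$, $[\varphi]\to[\psi]=[\varphi\to\psi]$, $\bot=[\bot]$ (so $\neg[\varphi]=[\neg\varphi]$).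 The Lindenbaum twist-structure $\mathcal{W}_L=\{([\varphi]_L,[\sim\varphi]_L)\}$ has ideal $\Delta_L=\{[\varphi\wedge\sim\varphi]_L:\varphi\text{ a formula}\}$, an ideal of $\mathcal{T}(L)$. An ideal $\Delta$ is closed if $\neg\neg a\in\Delta$ for all $a\in\Delta$. -}

module Defs where

open import Data.Nat using (ℕ)
open import Data.Product using (Σ; _×_)

infixr 4 _⇒_
infixr 5 _∨_
infixr 6 _∧_
infix 7 ∼_

data Fm : Set where
  var  : ℕ → Fm
  _∧_  : Fm → Fm → Fm
  _∨_  : Fm → Fm → Fm
  _⇒_  : Fm → Fm → Fm
  falsum : Fm
  ∼_   : Fm → Fm

¬f_ : Fm → Fm
¬f φ = φ ⇒ falsum

_⇔f_ : Fm → Fm → Fm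
φ ⇔f ψ = (φ ⇒ ψ) ∧ (ψ ⇒ φ)

sub : (ℕ → Fm) → Fm → Fm
sub σ (var n) = σ n
sub σ (φ ∧ ψ) = sub σ φ ∧ sub σ ψ
sub σ (φ ∨ ψ) = sub σ φ ∨ sub σ ψ
sub σ (φ ⇒ ψ) = sub σ φ ⇒ sub σ ψ
sub σ falsum = falsum
sub σ (∼ φ) = ∼ sub σ φ

p q r : Fm
p = var 0
q = var 1
r = var 2

record IsLogic (L : Fm → Set) : Set where
  field
    closed-sub : ∀ σ φ → L φ → L (sub σ φ)
    closed-mp  : ∀ φ ψ → L φ → L (φ ⇒ ψ) → L ψ

-- Axioms of N4⊥ (N4⊥ is the least logic containing them, so a logic
-- extends N4⊥ iff it contains all of them).
record ContainsN4⊥ (L : Fm → Set) : Set where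
  field
    ax1  : L (p ⇒ (q ⇒ p))
    ax2  : L ((p ⇒ (q ⇒ r)) ⇒ ((p ⇒ q) ⇒ (p ⇒ r)))
    ax3  : L (p ∧ q ⇒ p)
    ax4  : L (p ∧ q ⇒ q)
    ax5  : L (p ⇒ (q ⇒ p ∧ q))
    ax6  : L (p ⇒ p ∨ q)
    ax7  : L (q ⇒ p ∨ q)
    ax8  : L ((p ⇒ r) ⇒ ((q ⇒ r) ⇒ (p ∨ q ⇒ r)))
    ax9  : L (falsum ⇒ p)
    ax10 : L ((∼ (p ∨ q)) ⇔f (∼ p ∧ ∼ q))
    ax11 : L ((∼ (p ∧ q)) ⇔f (∼ p ∨ ∼ q))
    ax12 : L ((∼ (p ⇒ q)) ⇔f (p ∧ ∼ q))
    ax13 : L ((∼ ∼ p) ⇔f p)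
    ax14 : L (∼ falsum)

record ExtensionN4⊥ (L : Fm → Set) : Set where
  field
    isLogic  : IsLogic L
    contains : ContainsN4⊥ L

_≡[_]_ : Fm → (Fm → Set) → Fm → Set
φ ≡[ L ] ψ = L (φ ⇔f ψ)

-- Elements of T(L) are represented by formulas, with equality ≡_L
-- (setoid presentation of the quotient). The operations are syntactic,
-- in particular ¬[φ] = [¬φ].
InΔ : (Fm → Set) → Fm → Set
InΔ L φ = Σ Fm (λ ψ → φ ≡[ L ] (ψ ∧ ∼ ψ))

ΔClosed : (Fm → Set) → Set
ΔClosed L = ∀ φ → InΔ L φ → InΔ L (¬f ¬f φ)

-- Substituting a single formula A for every variable turns any contradiction
-- ψ ∧ ∼ψ into one that entails A ∧ ∼A: the strong-negation axioms push ∼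
-- inward until it meets a variable.  So if ¬¬(p ∧ ∼p) ≡ ψ ∧ ∼ψ, substituting
-- p everywhere gives ¬¬(p ∧ ∼p) → p ∧ ∼p.  Conversely, if ¬¬(p ∧ ∼p) ↔ p ∧ ∼p,
-- then for φ ≡ ψ ∧ ∼ψ we get ¬¬φ ≡ ¬¬(ψ ∧ ∼ψ) ≡ ψ ∧ ∼ψ.
module Submission where

open import Defs
open import Data.Nat using (ℕ; zero; suc)
open import Data.List using (List; []; _∷_)
open import Data.List.Membership.Propositional using (_∈_)
open import Data.List.Relation.Unary.Any using (here; there)
open import Data.Product using (_,_)
open import Function.Base using (const)
open import Function.Bundles using (_⇔_; mk⇔)
open import Relation.Binary.PropositionalEquality using (refl)

pqr≔ : Fm → Fm → Fm → ℕ → Fm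
pqr≔ A B C zero          = A
pqr≔ A B C (suc zero)    = B
pqr≔ A B C (suc (suc _)) = C

infixl 8 _⟨_⟩

_⟨_⟩ : Fm → Fm → Fm
ψ ⟨ A ⟩ = sub (const A) ψ

infixr 4 _⇒⋆_

-- The most recent hypothesis is the head of the list and the innermost premise.
_⇒⋆_ : List Fm → Fm → Fm
[]      ⇒⋆ A = A
(B ∷ Γ) ⇒⋆ A = Γ ⇒⋆ (B ⇒ A)

module _ (L : Fm → Set) (ext : ExtensionN4⊥ L) where
  open ExtensionN4⊥ ext
  open IsLogic isLogic
  open ContainsN4⊥ contains

  private
    MP : ∀ {A B} → L (A ⇒ B) → L A → L B
    MP f a = closed-mp _ _ a f

    K : ∀ {A B} → L (A ⇒ (B ⇒ A))
    K {A} {B} = closed-sub (pqr≔ A B falsum) _ ax1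

    S : ∀ {A B C} → L ((A ⇒ (B ⇒ C)) ⇒ ((A ⇒ B) ⇒ (A ⇒ C)))
    S {A} {B} {C} = closed-sub (pqr≔ A B C) _ ax2

    I : ∀ {A} → L (A ⇒ A)
    I {A} = MP (MP (S {A} {A ⇒ A} {A}) K) K

    ⇒-trans : ∀ {A B C} → L (A ⇒ B) → L (B ⇒ C) → L (A ⇒ C)
    ⇒-trans f g = MP (MP S (MP K g)) f

  ⇒⋆-pure : ∀ Γ {A} → L A → L (Γ ⇒⋆ A)
  ⇒⋆-pure []      a = a
  ⇒⋆-pure (B ∷ Γ) a = ⇒⋆-pure Γ (MP K a)

  ⇒⋆-ap : ∀ Γ {A B} → L ((Γ ⇒⋆ (A ⇒ B)) ⇒ ((Γ ⇒⋆ A) ⇒ (Γ ⇒⋆ B)))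
  ⇒⋆-ap []      = I
  ⇒⋆-ap (C ∷ Γ) = ⇒-trans (MP (⇒⋆-ap Γ) (⇒⋆-pure Γ S)) (⇒⋆-ap Γ)

  infix 3 _⊢_

  data _⊢_ (Γ : List Fm) : Fm → Set where
    hyp : ∀ {A} → A ∈ Γ → Γ ⊢ A
    ax  : ∀ {A} → L A → Γ ⊢ A
    mp  : ∀ {A B} → Γ ⊢ A ⇒ B → Γ ⊢ A → Γ ⊢ B
    lam : ∀ {A B} → A ∷ Γ ⊢ B → Γ ⊢ A ⇒ B

  ⊢-sound : ∀ {Γ A} → Γ ⊢ A → L (Γ ⇒⋆ A)
  ⊢-sound {_ ∷ Γ} (hyp (here refl)) = ⇒⋆-pure Γ I
  ⊢-sound {_ ∷ Γ} (hyp (there h))   = MP (MP (⇒⋆-ap Γ) (⇒⋆-pure Γ K)) (⊢-sound (hyp h))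
  ⊢-sound {Γ}     (ax a)            = ⇒⋆-pure Γ a
  ⊢-sound {Γ}     (mp f a)          = MP (MP (⇒⋆-ap Γ) (⊢-sound f)) (⊢-sound a)
  ⊢-sound         (lam d)           = ⊢-sound d

  theorem : ∀ {A} → [] ⊢ A → L A
  theorem = ⊢-sound

  private
    variable
      Γ : List Fm
      A B C : Fm

    hyp₀ : A ∷ Γ ⊢ A
    hyp₀ = hyp (here refl)

    hyp₁ : B ∷ A ∷ Γ ⊢ A
    hyp₁ = hyp (there (here refl))

    axiom : ∀ σ {φ} → L φ → Γ ⊢ sub σ φ
    axiom σ a = ax (closed-sub σ _ a)

    by : L (A ⇒ B) → Γ ⊢ A → Γ ⊢ B
    by f = mp (ax f)

  ∧-intro : Γ ⊢ A → Γ ⊢ B → Γ ⊢ A ∧ B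
  ∧-intro {A = A} {B} a b = mp (mp (axiom (pqr≔ A B falsum) ax5) a) b

  ∧-elimˡ : Γ ⊢ A ∧ B → Γ ⊢ A
  ∧-elimˡ {A = A} {B} = mp (axiom (pqr≔ A B falsum) ax3)

  ∧-elimʳ : Γ ⊢ A ∧ B → Γ ⊢ B
  ∧-elimʳ {A = A} {B} = mp (axiom (pqr≔ A B falsum) ax4)

  ∨-elim : Γ ⊢ A ∨ B → A ∷ Γ ⊢ C → B ∷ Γ ⊢ C → Γ ⊢ C
  ∨-elim {A = A} {B} {C} d f g = mp (mp (mp (axiom (pqr≔ A B C) ax8) (lam f)) (lam g)) d

  ⊥-elim : Γ ⊢ falsum → Γ ⊢ A
  ⊥-elim {A = A} = mp (axiom (const A) ax9)

  ⇔-to : Γ ⊢ A ⇔f B → Γ ⊢ A → Γ ⊢ B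
  ⇔-to e = mp (∧-elimˡ e)

  ⇔-from : Γ ⊢ A ⇔f B → Γ ⊢ B → Γ ⊢ A
  ⇔-from e = mp (∧-elimʳ e)

  ∼∨-elim : Γ ⊢ ∼ (A ∨ B) → Γ ⊢ ∼ A ∧ ∼ B
  ∼∨-elim {A = A} {B} = ⇔-to (axiom (pqr≔ A B falsum) ax10)

  ∼∧-elim : Γ ⊢ ∼ (A ∧ B) → Γ ⊢ ∼ A ∨ ∼ B
  ∼∧-elim {A = A} {B} = ⇔-to (axiom (pqr≔ A B falsum) ax11)

  ∼⇒-elim : Γ ⊢ ∼ (A ⇒ B) → Γ ⊢ A ∧ ∼ B
  ∼⇒-elim {A = A} {B} = ⇔-to (axiom (pqr≔ A B falsum) ax12)

  ∼∼-elim : Γ ⊢ ∼ ∼ A → Γ ⊢ A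
  ∼∼-elim {A = A} = ⇔-to (axiom (const A) ax13)

  ⇔-refl : L (A ⇔f A)
  ⇔-refl = theorem (∧-intro (lam hyp₀) (lam hyp₀))

  ⇔-trans : L (A ⇔f B) → L (B ⇔f C) → L (A ⇔f C)
  ⇔-trans e f = theorem (∧-intro
    (lam (⇔-to   (ax f) (⇔-to   (ax e) hyp₀)))
    (lam (⇔-from (ax e) (⇔-from (ax f) hyp₀))))

  ¬¬-intro : L (A ⇒ ¬f ¬f A)
  ¬¬-intro = theorem (lam (lam (mp hyp₀ hyp₁)))

  ¬¬-mono : L (A ⇒ B) → L (¬f ¬f A ⇒ ¬f ¬f B)
  ¬¬-mono f = theorem (lam (lam (mp hyp₁ (lam (mp hyp₁ (by f hyp₀))))))

  ¬¬-cong : L (A ⇔f B) → L ((¬f ¬f A) ⇔f (¬f ¬f B))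
  ¬¬-cong e = theorem (∧-intro
    (ax (¬¬-mono (theorem (∧-elimˡ (ax e)))))
    (ax (¬¬-mono (theorem (∧-elimʳ (ax e))))))

  ⟨⟩-contradiction-entails : ∀ A ψ → L (ψ ⟨ A ⟩ ∧ ∼ ψ ⟨ A ⟩ ⇒ A ∧ ∼ A)
  ⟨⟩-contradiction-entails A (var _) = theorem (lam hyp₀)
  ⟨⟩-contradiction-entails A (ψ ∧ χ) = theorem (lam (∨-elim (∼∧-elim (∧-elimʳ hyp₀))
    (by (⟨⟩-contradiction-entails A ψ) (∧-intro (∧-elimˡ (∧-elimˡ hyp₁)) hyp₀))
    (by (⟨⟩-contradiction-entails A χ) (∧-intro (∧-elimʳ (∧-elimˡ hyp₁)) hyp₀))))
  ⟨⟩-contradiction-entails A (ψ ∨ χ) = theorem (lam (∨-elim (∧-elimˡ hyp₀)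
    (by (⟨⟩-contradiction-entails A ψ) (∧-intro hyp₀ (∧-elimˡ (∼∨-elim (∧-elimʳ hyp₁)))))
    (by (⟨⟩-contradiction-entails A χ) (∧-intro hyp₀ (∧-elimʳ (∼∨-elim (∧-elimʳ hyp₁)))))))
  ⟨⟩-contradiction-entails A (ψ ⇒ χ) = theorem (lam
    (by (⟨⟩-contradiction-entails A χ)
        (∧-intro (mp (∧-elimˡ hyp₀) (∧-elimˡ ψ∧∼χ)) (∧-elimʳ ψ∧∼χ))))
    where
    ψ∧∼χ : ∀ {Γ} → (ψ ⇒ χ) ⟨ A ⟩ ∧ ∼ (ψ ⇒ χ) ⟨ A ⟩ ∷ Γ ⊢ ψ ⟨ A ⟩ ∧ ∼ χ ⟨ A ⟩
    ψ∧∼χ = ∼⇒-elim (∧-elimʳ hyp₀)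
  ⟨⟩-contradiction-entails A falsum = theorem (lam (⊥-elim (∧-elimˡ hyp₀)))
  ⟨⟩-contradiction-entails A (∼ ψ) = theorem (lam
    (by (⟨⟩-contradiction-entails A ψ)
        (∧-intro (∼∼-elim (∧-elimʳ hyp₀)) (∧-elimˡ hyp₀))))

  contradiction∈Δ : ∀ ψ → InΔ L (ψ ∧ ∼ ψ)
  contradiction∈Δ ψ = ψ , ⇔-refl

  ΔClosed⇒¬¬-stable : ΔClosed L → L ((¬f ¬f (p ∧ ∼ p)) ⇔f (p ∧ ∼ p))
  ΔClosed⇒¬¬-stable closed with closed (p ∧ ∼ p) (contradiction∈Δ p)
  -- Substituting p for every variable leaves ¬¬(p ∧ ∼p) unchanged and sends ψ to ψ ⟨ p ⟩.
  ... | ψ , ¬¬p∧∼p≡ψ∧∼ψ = theorem (∧-intro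
    (lam (by (⟨⟩-contradiction-entails p ψ)
             (⇔-to (ax (closed-sub (const p) _ ¬¬p∧∼p≡ψ∧∼ψ)) hyp₀)))
    (ax ¬¬-intro))

  ¬¬-stable⇒ΔClosed : L ((¬f ¬f (p ∧ ∼ p)) ⇔f (p ∧ ∼ p)) → ΔClosed L
  ¬¬-stable⇒ΔClosed stable φ (ψ , φ≡ψ∧∼ψ) =
    ψ , ⇔-trans (¬¬-cong φ≡ψ∧∼ψ) (closed-sub (const ψ) _ stable)

proposition4p1p2 : (L : Fm → Set) → ExtensionN4⊥ L →
    (ΔClosed L ⇔ L ((¬f ¬f (p ∧ ∼ p)) ⇔f (p ∧ ∼ p)))
proposition4p1p2 L ext = mk⇔ (ΔClosed⇒¬¬-stable L ext) (¬¬-stable⇒ΔClosed L ext)
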